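{- Consider the three-user binary Multiple Access Adder Channel with noiseless feedback: at each time step each of three users sends a bit $x_i\in\{0,1\}$, the channel outputs $y=x_1+x_2+x_3\in\{0,1,2,3\}$, and every user learns all previous outputs before choosing its next input. Let $l\ge 1$, let each user $i\in\{1,2,3\}$ have a message set $[M_i]=\{1,\dots,2^l\}$, and identify each message $m_i$ with a binary string $b_i=(b_i^{(1)},\dots,b_i^{(l)})\in\{0,1\}^l$ by a fixed bijection. Define the following feedback code. Stage 1 ($l$ transmissions): for $k=1,\dots,l$, the users send $b_1^{(k)},b_2^{(k)},b_3^{(k)}$; denote the output by $y_k$. Stage 2: for each $k$ (in increasing order) with $y_k\in\{1,2\}$, the users send $b_1^{(k)}$, $1-b_2^{(k)}$, and $0$ respectively; denote the output by $y'_k$. Decoding: if $y_k=0$ decode $(b_1^{(k)},b_2^{(k)},b_3^{(k)})=(0,0,0)$; if $y_k=3$ decode $(1,1,1)$; if $y_k=1$ decode $(0,1,0),(0,0,1),(1,0,0)$ according as $y'_k=0,1,2$; if $y_k=2$ decode $(0,1,1),(1,1,0),(1,0,1)$ according as $y'_k=0,1,2$. Then this code is zero-error (for every triple of messages the decoder recovers $b_1,b_2,b_3$ exactly), the total number of transmissions is $l+a$ where $a=|\{k: y_k\in\{1,2\}\}|$, and when the three messages are independent and uniformly distributed the expected number of transmissions is $l+\tfrac{3l}{4}$, so that each user's asymptotic rate $\lim_{l\to\infty} \frac{\log_2 M_i}{\text{average number of transmissions}}$ equals $\tfrac{4}{7}$.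
   Context: The rate of user $i$ is $\log_2 M_i$ divided by the average number of channel uses, in the limit $l\to\infty$ with $M_1=M_2=M_3=2^l$. Since Stage 1 determines which positions $k$ have $y_k\in\{1,2\}$, all users know (via feedback) which Stage 2 transmissions occur. -}

module Defs where

open import Data.Bool using (Bool; true; false; not; if_then_else_)
open import Data.Nat using (ℕ; zero; suc; _+_; _*_; _^_)
open import Data.List using (List; []; _∷_; _++_; length; concatMap; map)
open import Data.Nat.ListAction using (sum)
open import Data.Vec using (Vec; []; _∷_; toList)
open import Data.Product using (_×_; _,_)
open import Data.Maybe using (Maybe; just; nothing)

b2n : Bool → ℕ
b2n false = 0
b2n true  = 1

mac : Bool → Bool → Bool → ℕ
mac x₁ x₂ x₃ = b2n x₁ + b2n x₂ + b2n x₃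

isMid : ℕ → Bool
isMid 1 = true
isMid 2 = true
isMid _ = false

Triple : ℕ → Set
Triple l = Vec Bool l × Vec Bool l × Vec Bool l

stage1 : ∀ {l} → Vec Bool l → Vec Bool l → Vec Bool l → Vec ℕ l
stage1 [] [] [] = []
stage1 (a ∷ as) (b ∷ bs) (c ∷ cs) = mac a b c ∷ stage1 as bs cs

-- Stage 2: for each k (increasing) with y_k ∈ {1,2}, users send
-- b1^(k), 1 - b2^(k), 0 (known to be needed via feedback of y_k)
stage2 : ∀ {l} → Vec Bool l → Vec Bool l → Vec Bool l → Vec ℕ l → List ℕ
stage2 [] [] [] [] = []
stage2 (a ∷ as) (b ∷ bs) (c ∷ cs) (y ∷ ys) =
  if isMid y then mac a (not b) false ∷ stage2 as bs cs ys
  else stage2 as bs cs ys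

output : ∀ {l} → Triple l → List ℕ
output (b₁ , b₂ , b₃) = toList (stage1 b₁ b₂ b₃) ++ stage2 b₁ b₂ b₃ (stage1 b₁ b₂ b₃)

transmissions : ∀ {l} → Triple l → ℕ
transmissions m = length (output m)

countMid : ∀ {l} → Vec ℕ l → ℕ
countMid [] = 0
countMid (y ∷ ys) = (if isMid y then 1 else 0) + countMid ys

decodeSym : ℕ → ℕ → Bool × Bool × Bool
decodeSym 0 _ = false , false , false
decodeSym 3 _ = true , true , true
decodeSym 1 0 = false , true , false
decodeSym 1 1 = false , false , true
decodeSym 1 _ = true , false , false
decodeSym 2 0 = false , true , true
decodeSym 2 1 = true , true , false
decodeSym 2 _ = true , false , true
decodeSym _ _ = false , false , false

consT : ∀ {l} → Bool × Bool × Bool → Triple l → Triple (suc l)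
consT (x , y , z) (as , bs , cs) = (x ∷ as) , (y ∷ bs) , (z ∷ cs)

mapMaybe' : ∀ {A B : Set} → (A → B) → Maybe A → Maybe B
mapMaybe' f (just x) = just (f x)
mapMaybe' f nothing = nothing

decodeAux : ∀ {l} → Vec ℕ l → List ℕ → Maybe (Triple l)
decodeAux [] [] = just ([] , [] , [])
decodeAux [] (_ ∷ _) = nothing
decodeAux (y ∷ ys) zs with isMid y
... | false = mapMaybe' (consT (decodeSym y 0)) (decodeAux ys zs)
... | true with zs
...   | [] = nothing
...   | z ∷ zs' = mapMaybe' (consT (decodeSym y z)) (decodeAux ys zs')

splitVec : (l : ℕ) → List ℕ → Maybe (Vec ℕ l × List ℕ)
splitVec zero xs = just ([] , xs)
splitVec (suc l) [] = nothing
splitVec (suc l) (x ∷ xs) with splitVec l xs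
... | nothing = nothing
... | just (v , r) = just ((x ∷ v) , r)

decode : (l : ℕ) → List ℕ → Maybe (Triple l)
decode l out with splitVec l out
... | nothing = nothing
... | just (ys , rest) = decodeAux ys rest

allVecs : (l : ℕ) → List (Vec Bool l)
allVecs zero = [] ∷ []
allVecs (suc l) = concatMap (λ v → (false ∷ v) ∷ (true ∷ v) ∷ []) (allVecs l)

-- sum of the number of transmissions over all 2^(3l) message triples;
-- the expected number under uniform independent messages is this / 8^l
totalTransmissions : ℕ → ℕ
totalTransmissions l =
  sum (concatMap (λ a → concatMap (λ b → map (λ c → transmissions (a , b , c))
        (allVecs l)) (allVecs l)) (allVecs l))

{-# OPTIONS --safe #-}
-- Each position k costs one channel use, plus a second one exactly when yₖ ∈ {1,2}; then
-- y′ₖ = b₁ + (1 − b₂) separates the three bit patterns of weight yₖ, so decoding is exact.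
-- Six of the eight patterns at a position have weight 1 or 2, so splitting off the first
-- position of all message triples gives T(l+1) = 14·8^l + 8·T(l) for the total number T(l)
-- of channel uses, whence 4·T(l) = 7·l·8^l. The average number of channel uses is exactly
-- 7l/4, so the rate l/(7l/4) = 4/7 is attained for every l, not only in the limit.
module Submission where

open import Defs
open import Data.Nat using (ℕ; suc; _+_; _*_; _^_; _≤_)
open import Data.Integer using (+_)
open import Data.Rational using (ℚ; _/_; ∣_∣; _-_; _<_; 0ℚ) renaming (_*_ to _*ℚ_; _≤_ to _≤ℚ_)
open import Data.Product using (_×_; _,_; ∃)
open import Data.Maybe using (just)
open import Data.Vec using (Vec)
open import Data.Bool using (Bool)
open import Relation.Binary.PropositionalEquality using (_≡_)

open import Data.Nat using (zero)
open import Data.Bool using (true; false; if_then_else_)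
open import Data.List using (List; []; _∷_; _++_; length; concatMap; map)
open import Data.List.Properties using (length-++; map-concatMap)
open import Data.Nat.ListAction using (sum)
open import Data.Nat.ListAction.Properties using (sum-++)
open import Data.Nat.Properties using (+-commutativeSemigroup; *-distribʳ-+; *-zeroʳ; *-identityʳ; *-comm)
open import Algebra.Properties.CommutativeSemigroup +-commutativeSemigroup
  using () renaming (interchange to +-interchange; x∙yz≈y∙xz to +-leftComm)
open import Data.Nat.Tactic.RingSolver using (solve-∀)
open import Data.Vec using ([]; _∷_; toList)
open import Data.Vec.Properties using (length-toList)
open import Data.Rational using (fromℚᵘ; toℚᵘ; nonNegative)
open import Data.Rational.Properties
  using (toℚᵘ-injective; toℚᵘ-homo-*; toℚᵘ-fromℚᵘ; +-inverseʳ; nonNegative⁻¹; nonNeg*nonNeg⇒nonNeg; <⇒≤; normalize-nonNeg)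
open import Data.Rational.Unnormalised using (mkℚᵘ)
import Data.Rational.Unnormalised as ℚᵘ
import Data.Rational.Unnormalised.Properties as ℚᵘ
import Data.Integer as ℤ
import Data.Integer.Properties as ℤ
open import Relation.Binary.PropositionalEquality using (refl; subst; cong; cong₂; sym; trans; module ≡-Reasoning)

splitVec-toList-++ : ∀ {l} (v : Vec ℕ l) (r : List ℕ) → splitVec l (toList v ++ r) ≡ just (v , r)
splitVec-toList-++ []      r = refl
splitVec-toList-++ (x ∷ v) r rewrite splitVec-toList-++ v r = refl

decodeAux-stages : ∀ {l} (a b c : Vec Bool l) →
  decodeAux (stage1 a b c) (stage2 a b c (stage1 a b c)) ≡ just (a , b , c)
decodeAux-stages [] [] [] = refl
decodeAux-stages (false ∷ a) (false ∷ b) (false ∷ c) rewrite decodeAux-stages a b c = refl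
decodeAux-stages (false ∷ a) (false ∷ b) (true  ∷ c) rewrite decodeAux-stages a b c = refl
decodeAux-stages (false ∷ a) (true  ∷ b) (false ∷ c) rewrite decodeAux-stages a b c = refl
decodeAux-stages (false ∷ a) (true  ∷ b) (true  ∷ c) rewrite decodeAux-stages a b c = refl
decodeAux-stages (true  ∷ a) (false ∷ b) (false ∷ c) rewrite decodeAux-stages a b c = refl
decodeAux-stages (true  ∷ a) (false ∷ b) (true  ∷ c) rewrite decodeAux-stages a b c = refl
decodeAux-stages (true  ∷ a) (true  ∷ b) (false ∷ c) rewrite decodeAux-stages a b c = refl
decodeAux-stages (true  ∷ a) (true  ∷ b) (true  ∷ c) rewrite decodeAux-stages a b c = refl

decode-output : ∀ l (m : Triple l) → decode l (output m) ≡ just m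
decode-output l (a , b , c)
  rewrite splitVec-toList-++ (stage1 a b c) (stage2 a b c (stage1 a b c)) = decodeAux-stages a b c

length-stage2 : ∀ {l} (a b c : Vec Bool l) (ys : Vec ℕ l) → length (stage2 a b c ys) ≡ countMid ys
length-stage2 [] [] [] [] = refl
length-stage2 (x ∷ a) (y ∷ b) (z ∷ c) (w ∷ ys) with isMid w
... | true  = cong suc (length-stage2 a b c ys)
... | false = length-stage2 a b c ys

transmissions-countMid : ∀ {l} (a b c : Vec Bool l) → transmissions (a , b , c) ≡ l + countMid (stage1 a b c)
transmissions-countMid {l} a b c = begin
  length (toList ys ++ stage2 a b c ys)         ≡⟨ length-++ (toList ys) ⟩
  length (toList ys) + length (stage2 a b c ys) ≡⟨ cong₂ _+_ (length-toList ys) (length-stage2 a b c ys) ⟩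
  l + countMid ys                               ∎
  where
  open ≡-Reasoning
  ys = stage1 a b c

∑ : ∀ {A : Set} → List A → (A → ℕ) → ℕ
∑ xs f = sum (map f xs)

∑-cong : ∀ {A : Set} (xs : List A) {f g : A → ℕ} → (∀ x → f x ≡ g x) → ∑ xs f ≡ ∑ xs g
∑-cong []       f≗g = refl
∑-cong (x ∷ xs) f≗g = cong₂ _+_ (f≗g x) (∑-cong xs f≗g)

∑-+ : ∀ {A : Set} (xs : List A) (f g : A → ℕ) → ∑ xs (λ x → f x + g x) ≡ ∑ xs f + ∑ xs g
∑-+ []       f g = refl
∑-+ (x ∷ xs) f g rewrite ∑-+ xs f g = +-interchange (f x) (g x) (∑ xs f) (∑ xs g)

∑-const : ∀ {A : Set} (xs : List A) (k : ℕ) → ∑ xs (λ _ → k) ≡ length xs * k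
∑-const []       k = refl
∑-const (x ∷ xs) k = cong (_+_ k) (∑-const xs k)

∑-*ʳ : ∀ {A : Set} (xs : List A) (f : A → ℕ) (p : ℕ) → ∑ xs (λ x → f x * p) ≡ ∑ xs f * p
∑-*ʳ []       f p = refl
∑-*ʳ (x ∷ xs) f p = trans (cong (_+_ (f x * p)) (∑-*ʳ xs f p)) (sym (*-distribʳ-+ p (f x) (∑ xs f)))

∑-comm : ∀ {A B : Set} (xs : List A) (ys : List B) (f : A → B → ℕ) →
  ∑ xs (λ x → ∑ ys (f x)) ≡ ∑ ys (λ y → ∑ xs (λ x → f x y))
∑-comm []       ys f = sym (trans (∑-const ys 0) (*-zeroʳ (length ys)))
∑-comm (x ∷ xs) ys f = begin
  ∑ ys (f x) + ∑ xs (λ x′ → ∑ ys (f x′))          ≡⟨ cong (_+_ (∑ ys (f x))) (∑-comm xs ys f) ⟩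
  ∑ ys (f x) + ∑ ys (λ y → ∑ xs (λ x′ → f x′ y))  ≡⟨ ∑-+ ys (f x) _ ⟨
  ∑ ys (λ y → f x y + ∑ xs (λ x′ → f x′ y))       ∎
  where open ≡-Reasoning

sum-concatMap : ∀ {A : Set} (h : A → List ℕ) (xs : List A) → sum (concatMap h xs) ≡ ∑ xs (λ x → sum (h x))
sum-concatMap h []       = refl
sum-concatMap h (x ∷ xs) = trans (sum-++ (h x) (concatMap h xs)) (cong (_+_ (sum (h x))) (sum-concatMap h xs))

∑-concatMap : ∀ {A B : Set} (h : A → List B) (xs : List A) (f : B → ℕ) →
  ∑ (concatMap h xs) f ≡ ∑ xs (λ x → ∑ (h x) f)
∑-concatMap h xs f = trans (cong sum (map-concatMap f h xs)) (sum-concatMap (λ x → map f (h x)) xs)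

bits : List Bool
bits = false ∷ true ∷ []

∑-allVecs-suc : ∀ l (f : Vec Bool (suc l) → ℕ) →
  ∑ (allVecs (suc l)) f ≡ ∑ bits (λ x → ∑ (allVecs l) (λ v → f (x ∷ v)))
∑-allVecs-suc l f = trans (∑-concatMap (λ v → (false ∷ v) ∷ (true ∷ v) ∷ []) (allVecs l) f)
                          (∑-comm (allVecs l) bits (λ v x → f (x ∷ v)))

∑³ : ∀ {A : Set} → List A → (A → A → A → ℕ) → ℕ
∑³ xs f = ∑ xs λ x → ∑ xs λ y → ∑ xs λ z → f x y z

∑³-cong : ∀ {A : Set} (xs : List A) {f g : A → A → A → ℕ} →
  (∀ x y z → f x y z ≡ g x y z) → ∑³ xs f ≡ ∑³ xs g
∑³-cong xs f≗g = ∑-cong xs λ x → ∑-cong xs λ y → ∑-cong xs λ z → f≗g x y z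

∑³-+ : ∀ {A : Set} (xs : List A) (f g : A → A → A → ℕ) →
  ∑³ xs (λ x y z → f x y z + g x y z) ≡ ∑³ xs f + ∑³ xs g
∑³-+ xs f g = trans (∑-cong xs λ x → trans (∑-cong xs λ y → ∑-+ xs (f x y) (g x y)) (∑-+ xs _ _)) (∑-+ xs _ _)

∑³-*ʳ : ∀ {A : Set} (xs : List A) (f : A → A → A → ℕ) (p : ℕ) →
  ∑³ xs (λ x y z → f x y z * p) ≡ ∑³ xs f * p
∑³-*ʳ xs f p = trans (∑-cong xs λ x → trans (∑-cong xs λ y → ∑-*ʳ xs (f x y) p) (∑-*ʳ xs _ p)) (∑-*ʳ xs _ p)

∑³-const : ∀ {A : Set} (xs : List A) (k : ℕ) →
  ∑³ xs (λ _ _ _ → k) ≡ length xs * (length xs * (length xs * k))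
∑³-const xs k = trans (∑-cong xs λ _ → trans (∑-cong xs λ _ → ∑-const xs k) (∑-const xs _)) (∑-const xs _)

∑³-allVecs-suc : ∀ l (f : Vec Bool (suc l) → Vec Bool (suc l) → Vec Bool (suc l) → ℕ) →
  ∑³ (allVecs (suc l)) f ≡ ∑³ bits (λ z y x → ∑³ (allVecs l) (λ a b c → f (x ∷ a) (y ∷ b) (z ∷ c)))
∑³-allVecs-suc l f = begin
  ∑ V⁺ (λ a → ∑ V⁺ (λ b → ∑ V⁺ (λ c → f a b c)))
    ≡⟨ ∑-cong V⁺ (λ a → ∑-cong V⁺ (λ b → ∑-allVecs-suc l (f a b))) ⟩
  ∑ V⁺ (λ a → ∑ V⁺ (λ b → ∑ bits (λ z → last a b z)))
    ≡⟨ ∑-cong V⁺ (λ a → ∑-comm V⁺ bits (last a)) ⟩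
  ∑ V⁺ (λ a → ∑ bits (λ z → ∑ V⁺ (λ b → last a b z)))
    ≡⟨ ∑-cong V⁺ (λ a → ∑-cong bits (λ z → ∑-allVecs-suc l (λ b → last a b z))) ⟩
  ∑ V⁺ (λ a → ∑ bits (λ z → ∑ bits (λ y → lastTwo a y z)))
    ≡⟨ ∑-comm V⁺ bits (λ a z → ∑ bits (λ y → lastTwo a y z)) ⟩
  ∑ bits (λ z → ∑ V⁺ (λ a → ∑ bits (λ y → lastTwo a y z)))
    ≡⟨ ∑-cong bits (λ z → ∑-comm V⁺ bits (λ a y → lastTwo a y z)) ⟩
  ∑ bits (λ z → ∑ bits (λ y → ∑ V⁺ (λ a → lastTwo a y z)))
    ≡⟨ ∑-cong bits (λ z → ∑-cong bits (λ y → ∑-allVecs-suc l (λ a → lastTwo a y z))) ⟩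
  ∑³ bits (λ z y x → ∑³ V (λ a b c → f (x ∷ a) (y ∷ b) (z ∷ c)))
    ∎
  where
  open ≡-Reasoning
  V  = allVecs l
  V⁺ = allVecs (suc l)
  last : Vec Bool (suc l) → Vec Bool (suc l) → Bool → ℕ
  last a b z = ∑ V (λ c → f a b (z ∷ c))
  lastTwo : Vec Bool (suc l) → Bool → Bool → ℕ
  lastTwo a y z = ∑ V (λ b → last a (y ∷ b) z)

∑³-allVecs-const : ∀ l k → ∑³ (allVecs l) (λ _ _ _ → k) ≡ k * 8 ^ l
∑³-allVecs-const zero    k = trans (∑³-const (allVecs 0) k) (singleton k)
  where
  singleton : ∀ k → 1 * (1 * (1 * k)) ≡ k * 1
  singleton = solve-∀
∑³-allVecs-const (suc l) k = begin
  ∑³ (allVecs (suc l)) (λ _ _ _ → k)               ≡⟨ ∑³-allVecs-suc l (λ _ _ _ → k) ⟩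
  ∑³ bits (λ _ _ _ → ∑³ (allVecs l) (λ _ _ _ → k)) ≡⟨ ∑³-cong bits (λ _ _ _ → ∑³-allVecs-const l k) ⟩
  ∑³ bits (λ _ _ _ → k * 8 ^ l)                    ≡⟨ ∑³-const bits (k * 8 ^ l) ⟩
  2 * (2 * (2 * (k * 8 ^ l)))                      ≡⟨ eightfold k (8 ^ l) ⟩
  k * 8 ^ suc l                                    ∎
  where
  open ≡-Reasoning
  eightfold : ∀ k p → 2 * (2 * (2 * (k * p))) ≡ k * (8 * p)
  eightfold = solve-∀

channelUses : Bool → Bool → Bool → ℕ
channelUses x y z = suc (if isMid (mac x y z) then 1 else 0)

transmissions-∷ : ∀ {l} x y z (a b c : Vec Bool l) →
  transmissions (x ∷ a , y ∷ b , z ∷ c) ≡ channelUses x y z + transmissions (a , b , c)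
transmissions-∷ {l} x y z a b c
  rewrite transmissions-countMid (x ∷ a) (y ∷ b) (z ∷ c) | transmissions-countMid a b c =
  cong suc (+-leftComm l (if isMid (mac x y z) then 1 else 0) (countMid (stage1 a b c)))

totalTransmissions-∑³ : ∀ l → totalTransmissions l ≡ ∑³ (allVecs l) (λ a b c → transmissions (a , b , c))
totalTransmissions-∑³ l =
  trans (sum-concatMap _ V) (∑-cong V λ a → sum-concatMap (λ b → map (λ c → transmissions (a , b , c)) V) V)
  where V = allVecs l

totalTransmissions-suc : ∀ l → totalTransmissions (suc l) ≡ 14 * 8 ^ l + 8 * totalTransmissions l
totalTransmissions-suc l = begin
  totalTransmissions (suc l)
    ≡⟨ totalTransmissions-∑³ (suc l) ⟩
  ∑³ (allVecs (suc l)) cost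
    ≡⟨ ∑³-allVecs-suc l cost ⟩
  ∑³ bits (λ z y x → ∑³ V (λ a b c → cost (x ∷ a) (y ∷ b) (z ∷ c)))
    ≡⟨ ∑³-cong bits (λ z y x → trans (∑³-cong V (transmissions-∷ x y z)) (∑³-+ V _ cost)) ⟩
  ∑³ bits (λ z y x → ∑³ V (λ _ _ _ → channelUses x y z) + T)
    ≡⟨ ∑³-cong bits (λ z y x → cong (_+ T) (∑³-allVecs-const l (channelUses x y z))) ⟩
  ∑³ bits (λ z y x → channelUses x y z * 8 ^ l + T)
    ≡⟨ ∑³-+ bits (λ z y x → channelUses x y z * 8 ^ l) (λ _ _ _ → T) ⟩
  ∑³ bits (λ z y x → channelUses x y z * 8 ^ l) + ∑³ bits (λ _ _ _ → T)
    ≡⟨ cong₂ _+_ (∑³-*ʳ bits (λ z y x → channelUses x y z) (8 ^ l)) (∑³-const bits T) ⟩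
  14 * 8 ^ l + 2 * (2 * (2 * T))
    ≡⟨ cong (_+_ (14 * 8 ^ l)) (cubeTwo T) ⟩
  14 * 8 ^ l + 8 * T
    ≡⟨ cong (λ t → 14 * 8 ^ l + 8 * t) (totalTransmissions-∑³ l) ⟨
  14 * 8 ^ l + 8 * totalTransmissions l
    ∎
  where
  open ≡-Reasoning
  V = allVecs l
  cost : ∀ {n} → Vec Bool n → Vec Bool n → Vec Bool n → ℕ
  cost a b c = transmissions (a , b , c)
  T = ∑³ V cost
  cubeTwo : ∀ t → 2 * (2 * (2 * t)) ≡ 8 * t
  cubeTwo = solve-∀

totalTransmissions-closed : ∀ l → 4 * totalTransmissions l ≡ 7 * (l * 8 ^ l)
totalTransmissions-closed zero    = refl
totalTransmissions-closed (suc l) = begin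
  4 * totalTransmissions (suc l)          ≡⟨ cong (4 *_) (totalTransmissions-suc l) ⟩
  4 * (14 * 8 ^ l + 8 * T)                ≡⟨ regroup (8 ^ l) T ⟩
  56 * 8 ^ l + 8 * (4 * T)                ≡⟨ cong (λ t → 56 * 8 ^ l + 8 * t) (totalTransmissions-closed l) ⟩
  56 * 8 ^ l + 8 * (7 * (l * 8 ^ l))      ≡⟨ collect l (8 ^ l) ⟩
  7 * (suc l * 8 ^ suc l)                 ∎
  where
  open ≡-Reasoning
  T = totalTransmissions l
  regroup : ∀ p t → 4 * (14 * p + 8 * t) ≡ 56 * p + 8 * (4 * t)
  regroup = solve-∀
  collect : ∀ l p → 56 * p + 8 * (7 * (l * p)) ≡ 7 * (suc l * (8 * p))
  collect = solve-∀

fromℚᵘ-*-≃ : ∀ p q r → p ℚᵘ.* q ℚᵘ.≃ r → fromℚᵘ p *ℚ fromℚᵘ q ≡ fromℚᵘ r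
fromℚᵘ-*-≃ p q r pq≃r = toℚᵘ-injective (begin
  toℚᵘ (fromℚᵘ p *ℚ fromℚᵘ q)              ≈⟨ toℚᵘ-homo-* (fromℚᵘ p) (fromℚᵘ q) ⟩
  toℚᵘ (fromℚᵘ p) ℚᵘ.* toℚᵘ (fromℚᵘ q)     ≈⟨ ℚᵘ.*-cong (toℚᵘ-fromℚᵘ p) (toℚᵘ-fromℚᵘ q) ⟩
  p ℚᵘ.* q                                 ≈⟨ pq≃r ⟩
  r                                        ≈⟨ toℚᵘ-fromℚᵘ r ⟨
  toℚᵘ (fromℚᵘ r)                          ∎)
  where open ℚᵘ.≃-Reasoning

frac*nat≡nat : ∀ p d m n → p * m ≡ suc d * n → (+ p / suc d) *ℚ (+ m / 1) ≡ + n / 1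
frac*nat≡nat p d m n pm≡dn = fromℚᵘ-*-≃ (mkℚᵘ (+ p) d) (mkℚᵘ (+ m) 0) (mkℚᵘ (+ n) 0) (ℚᵘ.*≡* (begin
  (+ p ℤ.* + m) ℤ.* + 1  ≡⟨ cong (ℤ._* + 1) (ℤ.pos-* p m) ⟨
  + (p * m) ℤ.* + 1      ≡⟨ ℤ.pos-* (p * m) 1 ⟨
  + (p * m * 1)          ≡⟨ cong +_ (trans (*-identityʳ (p * m)) (trans pm≡dn (*-comm (suc d) n))) ⟩
  + (n * suc d)          ≡⟨ cong (λ k → + (n * k)) (*-identityʳ (suc d)) ⟨
  + (n * (suc d * 1))    ≡⟨ ℤ.pos-* n (suc d * 1) ⟩
  + n ℤ.* + (suc d * 1)  ∎))
  where open ≡-Reasoning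

rate-exact : ∀ l → (+ 4 / 7) *ℚ (+ totalTransmissions l / 1) ≡ + (l * 8 ^ l) / 1
rate-exact l = frac*nat≡nat 4 6 (totalTransmissions l) (l * 8 ^ l) (totalTransmissions-closed l)

rate-gap-zero : ∀ l → ∣ (+ (l * 8 ^ l) / 1) - (+ 4 / 7) *ℚ (+ totalTransmissions l / 1) ∣ ≡ 0ℚ
rate-gap-zero l rewrite rate-exact l = cong ∣_∣ (+-inverseʳ (+ (l * 8 ^ l) / 1))

0≤pos*nat : ∀ {ε} → 0ℚ < ε → ∀ n → 0ℚ ≤ℚ ε *ℚ (+ n / 1)
0≤pos*nat {ε} 0<ε n = nonNegative⁻¹ (ε *ℚ (+ n / 1))
  {{nonNeg*nonNeg⇒nonNeg ε {{nonNegative (<⇒≤ 0<ε)}} (+ n / 1) {{normalize-nonNeg n 1}}}}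

mainTheorem1 :
    ((l : ℕ) → 1 ≤ l → (m : Triple l) → decode l (output m) ≡ just m)
    × ((l : ℕ) → 1 ≤ l → (b₁ b₂ b₃ : Vec Bool l) →
        transmissions (b₁ , b₂ , b₃) ≡ l + countMid (stage1 b₁ b₂ b₃))
    × ((l : ℕ) → 1 ≤ l → 4 * totalTransmissions l ≡ (4 * l + 3 * l) * 8 ^ l)
    × ((ε : ℚ) → 0ℚ < ε → ∃ λ N → (l : ℕ) → 1 ≤ l → N ≤ l →
        ∣ (+ (l * 8 ^ l) / 1) - (+ 4 / 7) *ℚ (+ totalTransmissions l / 1) ∣
          ≤ℚ ε *ℚ (+ totalTransmissions l / 1))
mainTheorem1 =
    (λ l _ → decode-output l)
  , (λ l _ → transmissions-countMid)
  , (λ l _ → trans (totalTransmissions-closed l) (sevenths l (8 ^ l)))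
  , λ ε 0<ε → 0 , λ l _ _ →
      subst (_≤ℚ ε *ℚ (+ totalTransmissions l / 1)) (sym (rate-gap-zero l))
            (0≤pos*nat 0<ε (totalTransmissions l))
  where
  sevenths : ∀ l p → 7 * (l * p) ≡ (4 * l + 3 * l) * p
  sevenths = solve-∀
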